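{- Let $n\ge1$ and let $\sigma\in\mathcal{S}_n$ have order $n$. Suppose $\xi,\eta\in\mathcal{S}_n$ and natural numbers $k,l,r$ satisfy $\sigma^k\xi=\xi\sigma^l$, $\sigma^k\eta=\eta\sigma^r$ and $l\not\equiv r\pmod n$. Then $K_\xi\neq K_\eta$.
   Context: $\mathbb{N}$ is the set of nonnegative integers. $\mathcal{S}_n$ is the symmetric group on $[n]=\{1,\dots,n\}$, with products composed left to right: $(\alpha\beta)(i)=\beta(\alpha(i))$. For $\alpha\in\mathcal{S}_n$, $K_\alpha=\{\beta\in\mathcal{S}_n : \exists k,l\in\mathbb{N},\ \sigma^k\alpha=\beta\sigma^l\}$ is the $\sigma$-equivalence class of $\alpha$ (where $\alpha\sim\beta$ iff $\sigma^k\alpha=\beta\sigma^l$ for some $k,l\in\mathbb{N}$). -}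

module Defs where

open import Data.Nat using (ℕ; zero; suc; _<_)
open import Data.Fin using (Fin)
open import Data.Fin.Permutation using (Permutation′; id; _∘ₚ_; _⟨$⟩ʳ_)
open import Data.Product using (∃₂; _×_)
open import Relation.Binary.PropositionalEquality using (_≡_)
open import Relation.Nullary using (¬_)

_≈ₚ_ : ∀ {n} → Permutation′ n → Permutation′ n → Set
α ≈ₚ β = ∀ i → α ⟨$⟩ʳ i ≡ β ⟨$⟩ʳ i

-- Product α · β = α ∘ₚ β applies α first, then β:  (αβ)(i) = β(α(i)).
-- Power σ^k.
_^ₚ_ : ∀ {n} → Permutation′ n → ℕ → Permutation′ n
σ ^ₚ zero  = id
σ ^ₚ suc k = σ ∘ₚ (σ ^ₚ k)

HasOrder : ∀ {n} → Permutation′ n → ℕ → Set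
HasOrder σ m = (0 < m) × ((σ ^ₚ m) ≈ₚ id) × (∀ j → 0 < j → j < m → ¬ ((σ ^ₚ j) ≈ₚ id))

InK : ∀ {n} → Permutation′ n → Permutation′ n → Permutation′ n → Set
InK σ α β = ∃₂ λ k l → ((σ ^ₚ k) ∘ₚ α) ≈ₚ (β ∘ₚ (σ ^ₚ l))

SameClass : ∀ {n} → Permutation′ n → Permutation′ n → Permutation′ n → Set
SameClass σ α β = ∀ γ → (InK σ α γ → InK σ β γ) × (InK σ β γ → InK σ α γ)

-- If η ∈ K_ξ, say σ^a ξ = η σ^b, then conjugating the relation σ^k ξ = ξ σ^l by this
-- identity turns it into σ^k η = η σ^l; together with σ^k η = η σ^r this forces
-- σ^l = σ^r, and since σ has order n the exponents l and r agree modulo n.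
module Submission where

open import Defs
open import Data.Nat using (ℕ; zero; suc; _%_; _+_; _*_; _∸_; _/_; _<_)
open import Data.Nat.Properties using (+-comm; <-cmp; <⇒≤; m+[n∸m]≡n; m<n⇒0<n∸m; m∸n≤m; ≤-<-trans)
open import Data.Nat.DivMod using (m≡m%n+[m/n]*n; m%n<n)
open import Data.Fin using (Fin)
open import Data.Fin.Permutation using (Permutation′; id; _∘ₚ_; _⟨$⟩ʳ_; _⟨$⟩ˡ_; inverseʳ)
open import Data.Product using (_,_; proj₁; proj₂)
open import Data.Empty using (⊥-elim)
open import Function.Base using (_∘_)
open import Function.Bundles using (Injection)
open import Function.Properties.Inverse using (↔⇒↣)
open import Relation.Binary using (tri<; tri≈; tri>)
open import Relation.Binary.PropositionalEquality using (_≡_; refl; sym; trans; cong; subst; module ≡-Reasoning)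
open import Relation.Nullary using (¬_)

⟨$⟩ʳ-injective : ∀ {n} (π : Permutation′ n) {i j} → π ⟨$⟩ʳ i ≡ π ⟨$⟩ʳ j → i ≡ j
⟨$⟩ʳ-injective π = Injection.injective (↔⇒↣ π)

module _ {n : ℕ} (σ : Permutation′ n) where

  ^ₚ-+ : ∀ a b → (σ ^ₚ (a + b)) ≈ₚ ((σ ^ₚ a) ∘ₚ (σ ^ₚ b))
  ^ₚ-+ zero    b i = refl
  ^ₚ-+ (suc a) b i = ^ₚ-+ a b (σ ⟨$⟩ʳ i)

  ^ₚ-comm : ∀ a b → ((σ ^ₚ a) ∘ₚ (σ ^ₚ b)) ≈ₚ ((σ ^ₚ b) ∘ₚ (σ ^ₚ a))
  ^ₚ-comm a b i = begin
    (σ ^ₚ b) ⟨$⟩ʳ ((σ ^ₚ a) ⟨$⟩ʳ i) ≡⟨ ^ₚ-+ a b i ⟨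
    (σ ^ₚ (a + b)) ⟨$⟩ʳ i            ≡⟨ cong (λ c → (σ ^ₚ c) ⟨$⟩ʳ i) (+-comm a b) ⟩
    (σ ^ₚ (b + a)) ⟨$⟩ʳ i            ≡⟨ ^ₚ-+ b a i ⟩
    (σ ^ₚ a) ⟨$⟩ʳ ((σ ^ₚ b) ⟨$⟩ʳ i) ∎
    where open ≡-Reasoning

  ^ₚ-≈⇒^ₚ-∸≈id : ∀ {u v} → u < v → (σ ^ₚ u) ≈ₚ (σ ^ₚ v) → (σ ^ₚ (v ∸ u)) ≈ₚ id
  ^ₚ-≈⇒^ₚ-∸≈id {u} {v} u<v σᵘ≈σᵛ j = begin
    (σ ^ₚ (v ∸ u)) ⟨$⟩ʳ j                             ≡⟨ cong ((σ ^ₚ (v ∸ u)) ⟨$⟩ʳ_) (inverseʳ (σ ^ₚ u)) ⟨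
    (σ ^ₚ (v ∸ u)) ⟨$⟩ʳ ((σ ^ₚ u) ⟨$⟩ʳ i)             ≡⟨ ^ₚ-+ u (v ∸ u) i ⟨
    (σ ^ₚ (u + (v ∸ u))) ⟨$⟩ʳ i                       ≡⟨ cong (λ c → (σ ^ₚ c) ⟨$⟩ʳ i) (m+[n∸m]≡n (<⇒≤ u<v)) ⟩
    (σ ^ₚ v) ⟨$⟩ʳ i                                   ≡⟨ σᵘ≈σᵛ i ⟨
    (σ ^ₚ u) ⟨$⟩ʳ i                                   ≡⟨ inverseʳ (σ ^ₚ u) ⟩
    j                                                 ∎
    where
    open ≡-Reasoning
    i = (σ ^ₚ u) ⟨$⟩ˡ j

  intertwining-exponents-≈ : ∀ (ξ η : Permutation′ n) k l r a b →
    ((σ ^ₚ k) ∘ₚ ξ) ≈ₚ (ξ ∘ₚ (σ ^ₚ l)) →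
    ((σ ^ₚ k) ∘ₚ η) ≈ₚ (η ∘ₚ (σ ^ₚ r)) →
    ((σ ^ₚ a) ∘ₚ ξ) ≈ₚ (η ∘ₚ (σ ^ₚ b)) →
    (σ ^ₚ l) ≈ₚ (σ ^ₚ r)
  intertwining-exponents-≈ ξ η k l r a b ξ-twist η-twist ξ∼η j =
    subst (λ x → (σ ^ₚ l) ⟨$⟩ʳ x ≡ (σ ^ₚ r) ⟨$⟩ʳ x) (inverseʳ η)
      (⟨$⟩ʳ-injective (σ ^ₚ b) (at (η ⟨$⟩ˡ j)))
    where
    open ≡-Reasoning
    σ^ : ℕ → Fin n → Fin n
    σ^ c = (σ ^ₚ c) ⟨$⟩ʳ_
    at : ∀ i → σ^ b (σ^ l (η ⟨$⟩ʳ i)) ≡ σ^ b (σ^ r (η ⟨$⟩ʳ i))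
    at i = begin
      σ^ b (σ^ l (η ⟨$⟩ʳ i)) ≡⟨ ^ₚ-comm l b _ ⟩
      σ^ l (σ^ b (η ⟨$⟩ʳ i)) ≡⟨ cong (σ^ l) (ξ∼η i) ⟨
      σ^ l (ξ ⟨$⟩ʳ σ^ a i)   ≡⟨ ξ-twist (σ^ a i) ⟨
      ξ ⟨$⟩ʳ σ^ k (σ^ a i)   ≡⟨ cong (ξ ⟨$⟩ʳ_) (^ₚ-comm a k i) ⟩
      ξ ⟨$⟩ʳ σ^ a (σ^ k i)   ≡⟨ ξ∼η (σ^ k i) ⟩
      σ^ b (η ⟨$⟩ʳ σ^ k i)   ≡⟨ cong (σ^ b) (η-twist i) ⟩
      σ^ b (σ^ r (η ⟨$⟩ʳ i)) ∎

module _ {m : ℕ} (σ : Permutation′ (suc m)) (ord : HasOrder σ (suc m)) where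

  private
    σ^order≈id : (σ ^ₚ suc m) ≈ₚ id
    σ^order≈id = proj₁ (proj₂ ord)

    no-smaller-order : ∀ j → 0 < j → j < suc m → ¬ ((σ ^ₚ j) ≈ₚ id)
    no-smaller-order = proj₂ (proj₂ ord)

  ^ₚ-*-order≈id : ∀ q → (σ ^ₚ (q * suc m)) ≈ₚ id
  ^ₚ-*-order≈id zero    i = refl
  ^ₚ-*-order≈id (suc q) i = begin
    (σ ^ₚ (suc m + q * suc m)) ⟨$⟩ʳ i               ≡⟨ ^ₚ-+ σ (suc m) (q * suc m) i ⟩
    (σ ^ₚ (q * suc m)) ⟨$⟩ʳ ((σ ^ₚ suc m) ⟨$⟩ʳ i)   ≡⟨ cong ((σ ^ₚ (q * suc m)) ⟨$⟩ʳ_) (σ^order≈id i) ⟩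
    (σ ^ₚ (q * suc m)) ⟨$⟩ʳ i                       ≡⟨ ^ₚ-*-order≈id q i ⟩
    i                                               ∎
    where open ≡-Reasoning

  ^ₚ-% : ∀ x → (σ ^ₚ x) ≈ₚ (σ ^ₚ (x % suc m))
  ^ₚ-% x i = begin
    (σ ^ₚ x) ⟨$⟩ʳ i                                                ≡⟨ cong (λ c → (σ ^ₚ c) ⟨$⟩ʳ i) (m≡m%n+[m/n]*n x (suc m)) ⟩
    (σ ^ₚ (x % suc m + x / suc m * suc m)) ⟨$⟩ʳ i                  ≡⟨ ^ₚ-+ σ (x % suc m) (x / suc m * suc m) i ⟩
    (σ ^ₚ (x / suc m * suc m)) ⟨$⟩ʳ ((σ ^ₚ (x % suc m)) ⟨$⟩ʳ i)    ≡⟨ ^ₚ-*-order≈id (x / suc m) _ ⟩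
    (σ ^ₚ (x % suc m)) ⟨$⟩ʳ i                                      ∎
    where open ≡-Reasoning

  ^ₚ-distinct-below-order : ∀ {u v} → u < v → v < suc m → ¬ ((σ ^ₚ u) ≈ₚ (σ ^ₚ v))
  ^ₚ-distinct-below-order {u} {v} u<v v<order σᵘ≈σᵛ =
    no-smaller-order (v ∸ u) (m<n⇒0<n∸m u<v) (≤-<-trans (m∸n≤m v u) v<order)
      (^ₚ-≈⇒^ₚ-∸≈id σ u<v σᵘ≈σᵛ)

  ^ₚ-≈⇒^ₚ-%-≈ : ∀ l r → (σ ^ₚ l) ≈ₚ (σ ^ₚ r) → (σ ^ₚ (l % suc m)) ≈ₚ (σ ^ₚ (r % suc m))
  ^ₚ-≈⇒^ₚ-%-≈ l r σˡ≈σʳ i = trans (sym (^ₚ-% l i)) (trans (σˡ≈σʳ i) (^ₚ-% r i))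

  ^ₚ-≈⇒%-≡ : ∀ l r → (σ ^ₚ l) ≈ₚ (σ ^ₚ r) → l % suc m ≡ r % suc m
  ^ₚ-≈⇒%-≡ l r σˡ≈σʳ with <-cmp (l % suc m) (r % suc m)
  ... | tri< lt _ _ = ⊥-elim (^ₚ-distinct-below-order lt (m%n<n r (suc m)) (^ₚ-≈⇒^ₚ-%-≈ l r σˡ≈σʳ))
  ... | tri≈ _ eq _ = eq
  ... | tri> _ _ gt = ⊥-elim (^ₚ-distinct-below-order gt (m%n<n l (suc m)) (^ₚ-≈⇒^ₚ-%-≈ r l (sym ∘ σˡ≈σʳ)))

lemma3 : (m : ℕ) → (σ : Permutation′ (suc m)) → HasOrder σ (suc m) →
    (ξ η : Permutation′ (suc m)) → (k l r : ℕ) →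
    ((σ ^ₚ k) ∘ₚ ξ) ≈ₚ (ξ ∘ₚ (σ ^ₚ l)) →
    ((σ ^ₚ k) ∘ₚ η) ≈ₚ (η ∘ₚ (σ ^ₚ r)) →
    ¬ (l % suc m ≡ r % suc m) →
    ¬ SameClass σ ξ η
lemma3 m σ ord ξ η k l r ξ-twist η-twist l≢r same
  with proj₂ (same η) (0 , 0 , λ _ → refl)
... | a , b , ξ∼η =
  l≢r (^ₚ-≈⇒%-≡ σ ord l r (intertwining-exponents-≈ σ ξ η k l r a b ξ-twist η-twist ξ∼η))
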